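{- Let $L$ be a spatial complete lattice such that $\mathcal{J}$ has at most two levels. Then: (i) if $j\in\mathcal{J}\setminus\mathcal{A}$, then $j_\prec$ is a join of atoms; (ii) $L$ is atomic.
   Context: For a complete lattice $L$, $\mathcal{J}$ is its set of completely join-irreducible elements ($j$ with $j=\bigvee S\Rightarrow j\in S$ for all $S\subseteq L$) and $\mathcal{A}$ its set of atoms (elements covering $0$). $L$ is spatial if every $x$ equals $\bigvee\{j\in\mathcal{J}\mid j\le x\}$. $\mathcal{J}$ has at most two levels if for all $j,k\in\mathcal{J}$, $j<k$ implies $j$ is an atom. For $j\in\mathcal{J}$, $j_\prec=\bigvee\{x\in L\mid x<j\}$ is the unique element covered by $j$. $L$ is atomic if below every $x\ne0$ there is an atom. -}

module Defs where

open import Level using (Level; _⊔_; suc)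
open import Data.Product using (Σ; ∃; _×_; _,_)
open import Data.Empty using (⊥)
open import Relation.Nullary using (¬_)
open import Relation.Unary using (Pred)
open import Relation.Binary.Bundles using (Poset)

module _ {c ℓ₁ ℓ₂ : Level} (P : Poset c ℓ₁ ℓ₂) where
  open Poset P

  Lvl : Level
  Lvl = c ⊔ ℓ₁ ⊔ ℓ₂

  IsLub : ∀ {ℓ} → Pred Carrier ℓ → Carrier → Set (c ⊔ ℓ ⊔ ℓ₂)
  IsLub S x = (∀ s → S s → s ≤ x) × (∀ u → (∀ s → S s → s ≤ u) → x ≤ u)

  record IsCompleteLattice : Set (suc Lvl) where
    field
      ⋁     : Pred Carrier Lvl → Carrier
      ⋁-lub : ∀ S → IsLub S (⋁ S)

module CL {c ℓ₁ ℓ₂ : Level} {P : Poset c ℓ₁ ℓ₂} (L : IsCompleteLattice P) where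
  open Poset P
  open IsCompleteLattice L public

  _<_ : Carrier → Carrier → Set (ℓ₁ ⊔ ℓ₂)
  x < y = x ≤ y × ¬ (x ≈ y)

  ⊥L : Carrier
  ⊥L = ⋁ (λ _ → Level.Lift (Lvl P) ⊥)

  -- completely join-irreducible: j = ⋁ S implies j ∈ S (membership up to ≈)
  IsJ : Carrier → Set (suc (Lvl P))
  IsJ j = ∀ (S : Pred Carrier (Lvl P)) → j ≈ ⋁ S → ∃ λ k → S k × j ≈ k

  IsAtom : Carrier → Set (c ⊔ ℓ₁ ⊔ ℓ₂)
  IsAtom a = ⊥L < a × (∀ x → ⊥L < x → x < a → ⊥)

  Spatial : Set (suc (Lvl P))
  Spatial = ∀ x → IsLub P (λ j → IsJ j × j ≤ x) x

  AtMostTwoLevels : Set (suc (Lvl P))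
  AtMostTwoLevels = ∀ j k → IsJ j → IsJ k → j < k → IsAtom j

  lower : Carrier → Carrier
  lower j = ⋁ (λ x → Level.Lift (Lvl P) (x < j))

  JoinOfAtoms : Carrier → Set (suc (Lvl P))
  JoinOfAtoms x = ∃ λ (S : Pred Carrier (Lvl P)) → (∀ a → S a → IsAtom a) × x ≈ ⋁ S

  Atomic : Set (Lvl P)
  Atomic = ∀ x → ¬ (x ≈ ⊥L) → ∃ λ a → IsAtom a × a ≤ x

-- Below a completely join-irreducible j sit, by spatiality, only completely
-- join-irreducibles k < j, and with two levels these are atoms; so j_≺, the join
-- of everything strictly below j, is the join of the atoms below j. For
-- atomicity, pick j ∈ 𝒥 below x ≠ 0 (spatiality); if j is not an atom there is
-- some 0 < y < j, and any k ∈ 𝒥 below y satisfies k < j, hence is an atom.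
module Submission where

open import Defs
open import Level using (Level; _⊔_; suc; Lift; lift)
open import Data.Product using (_×_; _,_; ∃; proj₁; proj₂)
open import Data.Empty using (⊥-elim)
open import Relation.Nullary using (¬_; yes; no)
open import Relation.Unary using (Pred)
open import Relation.Binary.Bundles using (Poset)
import Relation.Binary.Construct.NonStrictToStrict as ToStrict
open import Axiom.ExcludedMiddle using (ExcludedMiddle)

module _ {c ℓ₁ ℓ₂ : Level} {P : Poset c ℓ₁ ℓ₂} (L : IsCompleteLattice P) where
  open Poset P
  open CL L

  ≤-<-trans : ∀ {x y z} → x ≤ y → y < z → x < z
  ≤-<-trans = ToStrict.≤-<-trans _≈_ _≤_ trans antisym ≤-respˡ-≈

  ⊥L-minimum : ∀ x → ⊥L ≤ x
  ⊥L-minimum x = proj₂ (⋁-lub _) x (λ _ ())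

  -- ⊥L is the join of the empty set, so it cannot be completely join-irreducible.
  IsJ⇒⊥L< : ∀ {j} → IsJ j → ⊥L < j
  IsJ⇒⊥L< {j} jJ = ⊥L-minimum j , λ ⊥L≈j → no-member (jJ _ (Eq.sym ⊥L≈j))
    where
    no-member : ¬ ∃ (λ k → Lift (Lvl P) _ × j ≈ k)
    no-member (_ , lift () , _)

  Spatial⇒IsJ-below : ExcludedMiddle (suc (Lvl P)) → Spatial →
                      ∀ x → ¬ x ≈ ⊥L → ∃ λ k → IsJ k × k ≤ x
  Spatial⇒IsJ-below lem spatial x x≉⊥L with lem {∃ λ k → IsJ k × k ≤ x}
  ... | yes k = k
  ... | no ¬k = ⊥-elim (x≉⊥L (antisym
          (proj₂ (spatial x) ⊥L (λ k k∈ → ⊥-elim (¬k (k , k∈))))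
          (⊥L-minimum x)))

  ¬IsAtom⇒∃-between : ExcludedMiddle (suc (Lvl P)) → ∀ {a} → ⊥L < a → ¬ IsAtom a →
                      ∃ λ y → ⊥L < y × y < a
  ¬IsAtom⇒∃-between lem {a} ⊥L<a ¬atom with lem {Lift _ (∃ λ y → ⊥L < y × y < a)}
  ... | yes (lift y) = y
  ... | no ¬y = ⊥-elim (¬atom (⊥L<a , λ y ⊥L<y y<a → ¬y (lift (y , ⊥L<y , y<a))))

  module _ (spatial : Spatial) (twoLevels : AtMostTwoLevels) where

    IsJ-below-IsJ⇒IsAtom : ∀ {j x k} → IsJ j → x < j → IsJ k → k ≤ x → IsAtom k
    IsJ-below-IsJ⇒IsAtom jJ x<j kJ k≤x = twoLevels _ _ kJ jJ (≤-<-trans k≤x x<j)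

    AtomsBelow : Carrier → Pred Carrier (Lvl P)
    AtomsBelow j a = IsAtom a × Lift (Lvl P) (a < j)

    lower≈⋁AtomsBelow : ∀ {j} → IsJ j → lower j ≈ ⋁ (AtomsBelow j)
    lower≈⋁AtomsBelow {j} jJ = antisym lower≤⋁atoms ⋁atoms≤lower
      where
      lower≤⋁atoms : lower j ≤ ⋁ (AtomsBelow j)
      lower≤⋁atoms = proj₂ (⋁-lub _) _ λ x (lift x<j) →
        proj₂ (spatial x) _ λ k (kJ , k≤x) →
          proj₁ (⋁-lub _) k (IsJ-below-IsJ⇒IsAtom jJ x<j kJ k≤x , lift (≤-<-trans k≤x x<j))
      ⋁atoms≤lower : ⋁ (AtomsBelow j) ≤ lower j
      ⋁atoms≤lower = proj₂ (⋁-lub _) _ λ a (_ , a<j) → proj₁ (⋁-lub _) a a<j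

    lower-JoinOfAtoms : ∀ {j} → IsJ j → JoinOfAtoms (lower j)
    lower-JoinOfAtoms jJ = _ , (λ _ → proj₁) , lower≈⋁AtomsBelow jJ

    IsJ⇒∃-IsAtom-below : ExcludedMiddle (suc (Lvl P)) →
                         ∀ {j} → IsJ j → ∃ λ a → IsAtom a × a ≤ j
    IsJ⇒∃-IsAtom-below lem {j} jJ with lem {Lift _ (IsAtom j)}
    ... | yes (lift atom) = j , atom , refl
    ... | no ¬atom
      with ¬IsAtom⇒∃-between lem (IsJ⇒⊥L< jJ) (λ atom → ¬atom (lift atom))
    ... | y , (_ , ⊥L≉y) , y<j
      with Spatial⇒IsJ-below lem spatial y (λ y≈⊥L → ⊥L≉y (Eq.sym y≈⊥L))
    ... | k , kJ , k≤y = k , IsJ-below-IsJ⇒IsAtom jJ y<j kJ k≤y , trans k≤y (proj₁ y<j)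

    Spatial⇒Atomic : ExcludedMiddle (suc (Lvl P)) → Atomic
    Spatial⇒Atomic lem x x≉⊥L with Spatial⇒IsJ-below lem spatial x x≉⊥L
    ... | j , jJ , j≤x with IsJ⇒∃-IsAtom-below lem jJ
    ... | a , atom , a≤j = a , atom , trans a≤j j≤x

lemma4p3 : ∀ {c ℓ₁ ℓ₂ : Level} → ExcludedMiddle (suc (c ⊔ ℓ₁ ⊔ ℓ₂))
    → (P : Poset c ℓ₁ ℓ₂) → (L : IsCompleteLattice P)
    → CL.Spatial L → CL.AtMostTwoLevels L
    → (∀ j → CL.IsJ L j → ¬ CL.IsAtom L j → CL.JoinOfAtoms L (CL.lower L j))
    × CL.Atomic L
-- Part (i) holds for every j ∈ 𝒥.
lemma4p3 lem P L spatial twoLevels =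
    (λ j jJ _ → lower-JoinOfAtoms L spatial twoLevels jJ)
  , Spatial⇒Atomic L spatial twoLevels lem
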